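{- Let $k, t, p \ge 1$ be integers with $t\le k$, and let $n=kp$. Define constant vectors $R=tpJ_{n-k,1}$ and $S=t(p-1)J_{n,1}$ (i.e., every entry of $R$ equals $tp$ and every entry of $S$ equals $t(p-1)$), and let $A$ be an $(n-k)\times n$ $(0,1)$-matrix with row sum vector $R$ and column sum vector $S$. Then the $n\times n$ matrix \[ V=\frac{1}{tp} \left[ \begin{array}{c} \begin{array}{cccc} tI_k & tI_k& \cdots & tI_k \end{array} \\ \hline A \end{array} \right], \] whose first $k$ rows consist of the block $tI_k$ repeated $p$ times side by side and whose last $n-k$ rows form the matrix $A$, is an RCDS doubly stochastic matrix.
   Context: A diagonal of an $n\times n$ matrix $X$ is the set of entries $x_{1,k_1},\ldots,x_{n,k_n}$ for a permutation $(k_1,\ldots,k_n)$ of $\{1,\ldots,n\}$; its sum is a diagonal sum. $\xi(X)$ denotes the set of positions where $X$ has zeros. An RCDS (restricted constant diagonal sum) doubly stochastic matrix is a doubly stochastic matrix $X$ (nonnegative, all row and column sums equal to 1) such that all diagonals of $X$ that avoid the positions in $\xi(X)$ have the same sum. $J_{m,1}$ denotes the $m\times 1$ all-ones vector and $I_k$ the $k\times k$ identity matrix. -}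

module Defs where

open import Data.Nat as ℕ using (ℕ; zero; suc; _<?_; _∸_; _%_; _<ᵇ_; _≡ᵇ_)
open import Data.Fin using (Fin; zero; suc; toℕ; fromℕ<)
open import Data.Fin.Permutation using (Permutation′; _⟨$⟩ʳ_)
open import Data.Integer using (+_)
open import Data.Rational using (ℚ; 0ℚ; 1ℚ; _+_; _≤_; _/_)
open import Data.Bool using (if_then_else_)
open import Data.Product using (_×_)
open import Relation.Nullary using (¬_; yes; no)
open import Relation.Binary.PropositionalEquality using (_≡_)

Matrix : Set → ℕ → ℕ → Set
Matrix A m n = Fin m → Fin n → A

∑ℚ : (n : ℕ) → (Fin n → ℚ) → ℚ
∑ℚ zero    f = 0ℚ
∑ℚ (suc n) f = f zero + ∑ℚ n (λ i → f (suc i))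

∑ℕ : (n : ℕ) → (Fin n → ℕ) → ℕ
∑ℕ zero    f = 0
∑ℕ (suc n) f = f zero ℕ.+ ∑ℕ n (λ i → f (suc i))

-- a / b as a rational number, for natural numbers (b = 0 gives 0; never used with b = 0)
_÷_ : ℕ → ℕ → ℚ
a ÷ zero  = 0ℚ
a ÷ suc b = (+ a) / suc b

DoublyStochastic : {n : ℕ} → Matrix ℚ n n → Set
DoublyStochastic {n} X =
  (∀ i j → 0ℚ ≤ X i j) ×
  (∀ i → ∑ℚ n (λ j → X i j) ≡ 1ℚ) ×
  (∀ j → ∑ℚ n (λ i → X i j) ≡ 1ℚ)

diagSum : {n : ℕ} → Matrix ℚ n n → Permutation′ n → ℚ
diagSum {n} X π = ∑ℚ n (λ i → X i (π ⟨$⟩ʳ i))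

AvoidsZeros : {n : ℕ} → Matrix ℚ n n → Permutation′ n → Set
AvoidsZeros X π = ∀ i → ¬ (X i (π ⟨$⟩ʳ i) ≡ 0ℚ)

RCDS : {n : ℕ} → Matrix ℚ n n → Set
RCDS X = DoublyStochastic X ×
  (∀ π σ → AvoidsZeros X π → AvoidsZeros X σ → diagSum X π ≡ diagSum X σ)

ZeroOne : {m n : ℕ} → Matrix ℕ m n → Set
ZeroOne A = ∀ i j → (A i j ≡ 0) Data.Sum.⊎ (A i j ≡ 1)
  where import Data.Sum

rowOf : {m n : ℕ} → Matrix ℕ m n → ℕ → Fin n → ℕ
rowOf {m} A r j with r <? m
... | yes r<m = A (fromℕ< r<m) j
... | no  _   = 0

-- j mod k (k = 0 gives j; never used with k = 0)
_mod_ : ℕ → ℕ → ℕ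
j mod zero  = j
j mod suc k = j % suc k

-- V = (1/(tp)) [ tI_k tI_k ... tI_k ; A ]  (n × n, first k rows are the block row,
-- last n - k rows are A).  Entry (i, j) of the block row [tI_k ... tI_k] is t iff j ≡ i (mod k).
Vmat : (k t p n : ℕ) → Matrix ℕ (n ∸ k) n → Matrix ℚ n n
Vmat k t p n A i j =
  if toℕ i <ᵇ k
  then (if toℕ i ≡ᵇ (toℕ j mod k) then t ÷ (t ℕ.* p) else 0ℚ)
  else rowOf A (toℕ i ∸ k) j ÷ (t ℕ.* p)

-- Scaled by tp, the entries of V in the first k rows are 0 or t and those in the last n - k rows are
-- 0 or 1, so a diagonal avoiding the zeros picks up the row's nonzero value in every row and all such
-- diagonals have the same sum.  Double stochasticity is counting: a row of [tI_k ⋯ tI_k] contains p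
-- copies of t, every column contains exactly one t among the first k rows, and A contributes row sums
-- tp and column sums t(p - 1).
module Submission where

open import Defs
open import Data.Nat using (ℕ; _≤_; _*_; _∸_)
open import Relation.Binary.PropositionalEquality using (_≡_)

open import Data.Bool using (true; false; if_then_else_)
open import Data.Fin using (Fin; zero; suc; toℕ; fromℕ<)
open import Data.Fin.Properties using (toℕ<n; fromℕ<-toℕ)
open import Data.Fin.Permutation using (_⟨$⟩ʳ_)
open import Data.Integer as ℤ using (+_)
open import Data.Integer.Properties using (pos-+; pos-*)
open import Data.Integer.Tactic.RingSolver using (solve-∀)
open import Data.Nat as ℕ using (zero; suc; _<_; _<ᵇ_; _≡ᵇ_; _%_; s≤s)
open import Data.Nat.DivMod using ([m+n]%n≡m%n; m%n<n; m<n⇒m%n≡m)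
import Data.Nat.Properties as ℕ
open import Data.Product using (_,_)
open import Data.Rational as ℚ using (ℚ; 0ℚ; 1ℚ; toℚᵘ)
open import Data.Rational.Properties as ℚ using (toℚᵘ-injective; toℚᵘ-homo-+; toℚᵘ-fromℚᵘ; 0/n≡0)
open import Data.Rational.Unnormalised as ℚᵘ using (mkℚᵘ; *≡*)
import Data.Rational.Unnormalised.Properties as ℚᵘ
open import Data.Sum using (_⊎_; inj₁; inj₂)
open import Relation.Binary.PropositionalEquality using (refl; sym; trans; cong; cong₂; subst; module ≡-Reasoning)
open import Relation.Nullary using (¬_; yes; no; contradiction)

0÷n≡0 : ∀ n → 0 ÷ n ≡ 0ℚ
0÷n≡0 zero    = refl
0÷n≡0 (suc n) = 0/n≡0 (suc n)

n÷n≡1 : ∀ d → suc d ÷ suc d ≡ 1ℚ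
n÷n≡1 d = toℚᵘ-injective (ℚᵘ.≃-trans (toℚᵘ-fromℚᵘ (mkℚᵘ (+ suc d) d)) (*≡* (cong +_ (ℕ.*-comm (suc d) 1))))

÷-nonNeg : ∀ a n → 0ℚ ℚ.≤ a ÷ n
÷-nonNeg a zero    = ℚ.≤-refl
÷-nonNeg a (suc n) = ℚ.nonNegative⁻¹ _ {{ℚ.normalize-nonNeg a (suc n)}}

÷-+ : ∀ a b d → a ÷ suc d ℚ.+ b ÷ suc d ≡ (a ℕ.+ b) ÷ suc d
÷-+ a b d = toℚᵘ-injective (begin
  toℚᵘ (a ÷ suc d ℚ.+ b ÷ suc d)          ≈⟨ toℚᵘ-homo-+ (a ÷ suc d) (b ÷ suc d) ⟩
  toℚᵘ (a ÷ suc d) ℚᵘ.+ toℚᵘ (b ÷ suc d)  ≈⟨ ℚᵘ.+-cong (toℚᵘ-fromℚᵘ (mkℚᵘ (+ a) d)) (toℚᵘ-fromℚᵘ (mkℚᵘ (+ b) d)) ⟩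
  mkℚᵘ (+ a) d ℚᵘ.+ mkℚᵘ (+ b) d          ≈⟨ *≡* common-denominator ⟩
  mkℚᵘ (+ (a ℕ.+ b)) d                    ≈⟨ toℚᵘ-fromℚᵘ (mkℚᵘ (+ (a ℕ.+ b)) d) ⟨
  toℚᵘ ((a ℕ.+ b) ÷ suc d)                ∎)
  where
  open ℚᵘ.≃-Reasoning
  identity : ∀ x y z → (x ℤ.* z ℤ.+ y ℤ.* z) ℤ.* z ≡ (x ℤ.+ y) ℤ.* (z ℤ.* z)
  identity = solve-∀
  common-denominator : (+ a ℤ.* + suc d ℤ.+ + b ℤ.* + suc d) ℤ.* + suc d
                     ≡ + (a ℕ.+ b) ℤ.* + (suc d ℕ.* suc d)
  common-denominator = trans (identity (+ a) (+ b) (+ suc d))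
                             (cong₂ ℤ._*_ (sym (pos-+ a b)) (sym (pos-* (suc d) (suc d))))

∑ℚ-cong : ∀ n {f g : Fin n → ℚ} → (∀ i → f i ≡ g i) → ∑ℚ n f ≡ ∑ℚ n g
∑ℚ-cong zero    f≡g = refl
∑ℚ-cong (suc n) f≡g = cong₂ ℚ._+_ (f≡g zero) (∑ℚ-cong n (λ i → f≡g (suc i)))

∑ℕ-cong : ∀ n {f g : Fin n → ℕ} → (∀ i → f i ≡ g i) → ∑ℕ n f ≡ ∑ℕ n g
∑ℕ-cong zero    f≡g = refl
∑ℕ-cong (suc n) f≡g = cong₂ ℕ._+_ (f≡g zero) (∑ℕ-cong n (λ i → f≡g (suc i)))

∑ℚ-÷ : ∀ n d (f : Fin n → ℕ) → ∑ℚ n (λ i → f i ÷ suc d) ≡ ∑ℕ n f ÷ suc d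
∑ℚ-÷ zero    d f = sym (0÷n≡0 (suc d))
∑ℚ-÷ (suc n) d f = trans (cong (f zero ÷ suc d ℚ.+_) (∑ℚ-÷ n d (λ i → f (suc i))))
                         (÷-+ (f zero) _ d)

∑ℚ-÷≡1 : ∀ n d (f : Fin n → ℕ) → ∑ℕ n f ≡ suc d → ∑ℚ n (λ i → f i ÷ suc d) ≡ 1ℚ
∑ℚ-÷≡1 n d f ∑f≡d = trans (∑ℚ-÷ n d f) (trans (cong (_÷ suc d) ∑f≡d) (n÷n≡1 d))

∑ℕ< : ℕ → (ℕ → ℕ) → ℕ
∑ℕ< n h = ∑ℕ n (λ i → h (toℕ i))

∑ℕ<-cong : ∀ n {h g : ℕ → ℕ} → (∀ m → m < n → h m ≡ g m) → ∑ℕ< n h ≡ ∑ℕ< n g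
∑ℕ<-cong n h≡g = ∑ℕ-cong n (λ i → h≡g (toℕ i) (toℕ<n i))

∑ℕ<-+ : ∀ a b h → ∑ℕ< (a ℕ.+ b) h ≡ ∑ℕ< a h ℕ.+ ∑ℕ< b (λ m → h (a ℕ.+ m))
∑ℕ<-+ zero    b h = refl
∑ℕ<-+ (suc a) b h = trans (cong (h 0 ℕ.+_) (∑ℕ<-+ a b (λ m → h (suc m))))
                          (sym (ℕ.+-assoc (h 0) _ _))

∑ℕ<-periodic : ∀ k p h → (∀ m → h (k ℕ.+ m) ≡ h m) → ∑ℕ< (p * k) h ≡ p * ∑ℕ< k h
∑ℕ<-periodic k zero    h periodic = refl
∑ℕ<-periodic k (suc p) h periodic = begin
  ∑ℕ< (k ℕ.+ p * k) h                             ≡⟨ ∑ℕ<-+ k (p * k) h ⟩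
  ∑ℕ< k h ℕ.+ ∑ℕ< (p * k) (λ m → h (k ℕ.+ m))    ≡⟨ cong (∑ℕ< k h ℕ.+_) (∑ℕ<-cong (p * k) (λ m _ → periodic m)) ⟩
  ∑ℕ< k h ℕ.+ ∑ℕ< (p * k) h                       ≡⟨ cong (∑ℕ< k h ℕ.+_) (∑ℕ<-periodic k p h periodic) ⟩
  ∑ℕ< k h ℕ.+ p * ∑ℕ< k h                         ∎
  where open ≡-Reasoning

∑ℕ<-zero : ∀ n → ∑ℕ< n (λ _ → 0) ≡ 0
∑ℕ<-zero zero    = refl
∑ℕ<-zero (suc n) = ∑ℕ<-zero n

∑ℕ<-indicator : ∀ {n c} t → c < n → ∑ℕ< n (λ m → if m ≡ᵇ c then t else 0) ≡ t
∑ℕ<-indicator {suc n} {zero}  t _         = trans (cong (t ℕ.+_) (∑ℕ<-zero n)) (ℕ.+-identityʳ t)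
∑ℕ<-indicator {suc n} {suc c} t (s≤s c<n) = ∑ℕ<-indicator t c<n

≡ᵇ-sym : ∀ a b → (a ≡ᵇ b) ≡ (b ≡ᵇ a)
≡ᵇ-sym zero    zero    = refl
≡ᵇ-sym zero    (suc b) = refl
≡ᵇ-sym (suc a) zero    = refl
≡ᵇ-sym (suc a) (suc b) = ≡ᵇ-sym a b

<⇒<ᵇ≡true : ∀ {m n} → m < n → (m <ᵇ n) ≡ true
<⇒<ᵇ≡true (s≤s ℕ.z≤n)         = refl
<⇒<ᵇ≡true (s≤s m<n@(s≤s _))  = <⇒<ᵇ≡true m<n

≤⇒<ᵇ≡false : ∀ {m n} → n ≤ m → (m <ᵇ n) ≡ false
≤⇒<ᵇ≡false ℕ.z≤n     = refl
≤⇒<ᵇ≡false (s≤s n≤m) = ≤⇒<ᵇ≡false n≤m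

module _ {n : ℕ} (X : Matrix ℚ n n) where

  rowConstant⇒equalDiagSums : (c : Fin n → ℚ) → (∀ i j → ¬ X i j ≡ 0ℚ → X i j ≡ c i) →
    ∀ π σ → AvoidsZeros X π → AvoidsZeros X σ → diagSum X π ≡ diagSum X σ
  rowConstant⇒equalDiagSums c const π σ π-avoids σ-avoids =
    trans (∑ℚ-cong n (λ i → const i (π ⟨$⟩ʳ i) (π-avoids i)))
          (sym (∑ℚ-cong n (λ i → const i (σ ⟨$⟩ʳ i) (σ-avoids i))))

  module _ (G : Matrix ℕ n n) (d : ℕ) (X≡G÷ : ∀ i j → X i j ≡ G i j ÷ suc d) where

    ÷-doublyStochastic : (∀ i → ∑ℕ n (G i) ≡ suc d) → (∀ j → ∑ℕ n (λ i → G i j) ≡ suc d) →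
                         DoublyStochastic X
    ÷-doublyStochastic rows cols =
      (λ i j → subst (0ℚ ℚ.≤_) (sym (X≡G÷ i j)) (÷-nonNeg (G i j) (suc d))) ,
      (λ i → trans (∑ℚ-cong n (X≡G÷ i)) (∑ℚ-÷≡1 n d (G i) (rows i))) ,
      (λ j → trans (∑ℚ-cong n (λ i → X≡G÷ i j)) (∑ℚ-÷≡1 n d (λ i → G i j) (cols j)))

    ÷-equalDiagSums : (c : Fin n → ℕ) → (∀ i j → G i j ≡ 0 ⊎ G i j ≡ c i) →
      ∀ π σ → AvoidsZeros X π → AvoidsZeros X σ → diagSum X π ≡ diagSum X σ
    ÷-equalDiagSums c zero-or-c = rowConstant⇒equalDiagSums (λ i → c i ÷ suc d) nonzero⇒c
      where
      nonzero⇒c : ∀ i j → ¬ X i j ≡ 0ℚ → X i j ≡ c i ÷ suc d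
      nonzero⇒c i j X≢0 with zero-or-c i j
      ... | inj₁ G≡0 = contradiction (trans (X≡G÷ i j) (trans (cong (_÷ suc d) G≡0) (0÷n≡0 (suc d)))) X≢0
      ... | inj₂ G≡c = trans (X≡G÷ i j) (cong (_÷ suc d) G≡c)

module _ {m n : ℕ} (A : Matrix ℕ m n) where

  rowOf-fromℕ< : ∀ {r} (r<m : r < m) j → rowOf A r j ≡ A (fromℕ< r<m) j
  rowOf-fromℕ< {r} r<m j with r ℕ.<? m
  ... | yes _   = refl
  ... | no  r≮m = contradiction r<m r≮m

  rowOf-toℕ : ∀ i j → rowOf A (toℕ i) j ≡ A i j
  rowOf-toℕ i j = trans (rowOf-fromℕ< (toℕ<n i) j) (cong (λ i′ → A i′ j) (fromℕ<-toℕ i (toℕ<n i)))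

  rowOf-zeroOne : ZeroOne A → ∀ r j → rowOf A r j ≡ 0 ⊎ rowOf A r j ≡ 1
  rowOf-zeroOne zero-one r j with r ℕ.<? m
  ... | yes r<m = zero-one (fromℕ< r<m) j
  ... | no  _   = inj₁ refl

  ∑ℕ<-rowOf : ∀ j → ∑ℕ< m (λ r → rowOf A r j) ≡ ∑ℕ m (λ i → A i j)
  ∑ℕ<-rowOf j = ∑ℕ-cong m (λ i → rowOf-toℕ i j)

blockEntry : (k t : ℕ) → ℕ → ℕ → ℕ
blockEntry k t i m = if i ≡ᵇ m mod k then t else 0

blockEntry-periodic : ∀ k t i m → blockEntry (suc k) t i (suc k ℕ.+ m) ≡ blockEntry (suc k) t i m
blockEntry-periodic k t i m =
  cong (λ r → if i ≡ᵇ r then t else 0) (trans (cong (_% suc k) (ℕ.+-comm (suc k) m)) ([m+n]%n≡m%n m (suc k)))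

blockRow-sum : ∀ k t p {i} → i < suc k → ∑ℕ< (p * suc k) (blockEntry (suc k) t i) ≡ p * t
blockRow-sum k t p {i} i<k = begin
  ∑ℕ< (p * suc k) (blockEntry (suc k) t i)       ≡⟨ ∑ℕ<-periodic (suc k) p _ (blockEntry-periodic k t i) ⟩
  p * ∑ℕ< (suc k) (blockEntry (suc k) t i)       ≡⟨ cong (p *_) (∑ℕ<-cong (suc k) one-period) ⟩
  p * ∑ℕ< (suc k) (λ m → if m ≡ᵇ i then t else 0) ≡⟨ cong (p *_) (∑ℕ<-indicator t i<k) ⟩
  p * t                                            ∎
  where
  open ≡-Reasoning
  one-period : ∀ m → m < suc k → blockEntry (suc k) t i m ≡ (if m ≡ᵇ i then t else 0)
  one-period m m<k = cong (λ b → if b then t else 0) (trans (cong (i ≡ᵇ_) (m<n⇒m%n≡m m<k)) (≡ᵇ-sym i m))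

blockColumn-sum : ∀ k t c → ∑ℕ< (suc k) (λ i → blockEntry (suc k) t i c) ≡ t
blockColumn-sum k t c = ∑ℕ<-indicator t (m%n<n c (suc k))

-- tp · V, with the row index as a natural number
Vnum : ∀ {n} (k t : ℕ) → Matrix ℕ (n ∸ k) n → ℕ → Fin n → ℕ
Vnum k t A i j = if i <ᵇ k then blockEntry k t i (toℕ j) else rowOf A (i ∸ k) j

module _ {n : ℕ} (k t : ℕ) (A : Matrix ℕ (n ∸ k) n) where

  Vmat≡Vnum÷ : ∀ p i j → Vmat k t p n A i j ≡ Vnum k t A (toℕ i) j ÷ (t * p)
  Vmat≡Vnum÷ p i j with toℕ i <ᵇ k | toℕ i ≡ᵇ toℕ j mod k
  ... | true  | true  = refl
  ... | true  | false = sym (0÷n≡0 (t * p))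
  ... | false | _     = refl

  Vnum-top : ∀ {i} → i < k → ∀ j → Vnum k t A i j ≡ blockEntry k t i (toℕ j)
  Vnum-top i<k j rewrite <⇒<ᵇ≡true i<k = refl

  Vnum-bottom : ∀ {i} → k ≤ i → ∀ j → Vnum k t A i j ≡ rowOf A (i ∸ k) j
  Vnum-bottom k≤i j rewrite ≤⇒<ᵇ≡false k≤i = refl

  Vnum-zeroOrRowConstant : ZeroOne A →
    ∀ i j → Vnum k t A i j ≡ 0 ⊎ Vnum k t A i j ≡ (if i <ᵇ k then t else 1)
  Vnum-zeroOrRowConstant zero-one i j with i <ᵇ k | i ≡ᵇ toℕ j mod k
  ... | true  | true  = inj₂ refl
  ... | true  | false = inj₁ refl
  ... | false | _     = rowOf-zeroOne A zero-one (i ∸ k) j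

module _ {n : ℕ} (k t : ℕ) (A : Matrix ℕ (n ∸ suc k) n) where

  Vnum-rowSum : ∀ p → n ≡ p * suc k → (∀ i → ∑ℕ n (A i) ≡ t * p) →
                ∀ (i : Fin n) → ∑ℕ n (Vnum (suc k) t A (toℕ i)) ≡ t * p
  Vnum-rowSum p n≡pk rowsA i with toℕ i ℕ.<? suc k
  ... | yes i<k = begin
    ∑ℕ n (Vnum (suc k) t A (toℕ i))                 ≡⟨ ∑ℕ-cong n (Vnum-top (suc k) t A i<k) ⟩
    ∑ℕ< n (blockEntry (suc k) t (toℕ i))            ≡⟨ cong (λ n′ → ∑ℕ< n′ (blockEntry (suc k) t (toℕ i))) n≡pk ⟩
    ∑ℕ< (p * suc k) (blockEntry (suc k) t (toℕ i))  ≡⟨ blockRow-sum k t p i<k ⟩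
    p * t                                           ≡⟨ ℕ.*-comm p t ⟩
    t * p                                           ∎
    where open ≡-Reasoning
  ... | no  i≮k = begin
    ∑ℕ n (Vnum (suc k) t A (toℕ i))     ≡⟨ ∑ℕ-cong n (Vnum-bottom (suc k) t A k≤i) ⟩
    ∑ℕ n (rowOf A (toℕ i ∸ suc k))      ≡⟨ ∑ℕ-cong n (rowOf-fromℕ< A i-k<n-k) ⟩
    ∑ℕ n (A (fromℕ< i-k<n-k))           ≡⟨ rowsA (fromℕ< i-k<n-k) ⟩
    t * p                               ∎
    where
    open ≡-Reasoning
    k≤i : suc k ≤ toℕ i
    k≤i = ℕ.≮⇒≥ i≮k
    i-k<n-k : toℕ i ∸ suc k < n ∸ suc k
    i-k<n-k = ℕ.∸-monoˡ-< (toℕ<n i) k≤i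

  Vnum-columnSum : suc k ≤ n → ∀ j →
    ∑ℕ n (λ i → Vnum (suc k) t A (toℕ i) j) ≡ t ℕ.+ ∑ℕ (n ∸ suc k) (λ i → A i j)
  Vnum-columnSum k<n j = begin
    ∑ℕ< n V                                               ≡⟨ cong (λ n′ → ∑ℕ< n′ V) (sym (ℕ.m+[n∸m]≡n k<n)) ⟩
    ∑ℕ< (suc k ℕ.+ (n ∸ suc k)) V                         ≡⟨ ∑ℕ<-+ (suc k) (n ∸ suc k) V ⟩
    ∑ℕ< (suc k) V ℕ.+ ∑ℕ< (n ∸ suc k) (λ i → V (suc k ℕ.+ i)) ≡⟨ cong₂ ℕ._+_ top bottom ⟩
    t ℕ.+ ∑ℕ (n ∸ suc k) (λ i → A i j)                    ∎
    where
    open ≡-Reasoning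
    V : ℕ → ℕ
    V i = Vnum (suc k) t A i j
    top : ∑ℕ< (suc k) V ≡ t
    top = trans (∑ℕ<-cong (suc k) (λ i i<k → Vnum-top (suc k) t A i<k j)) (blockColumn-sum k t (toℕ j))
    bottom : ∑ℕ< (n ∸ suc k) (λ i → V (suc k ℕ.+ i)) ≡ ∑ℕ (n ∸ suc k) (λ i → A i j)
    bottom = trans (∑ℕ<-cong (n ∸ suc k) (λ i _ → trans (Vnum-bottom (suc k) t A (ℕ.m≤m+n (suc k) i) j)
                                                        (cong (λ r → rowOf A r j) (ℕ.m+n∸m≡n (suc k) i))))
                   (∑ℕ<-rowOf A j)

theorem2p2 : (k t p n : ℕ) → 1 ≤ k → 1 ≤ t → 1 ≤ p → t ≤ k → n ≡ k * p →
    (A : Matrix ℕ (n ∸ k) n) → ZeroOne A →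
    (∀ i → ∑ℕ n (λ j → A i j) ≡ t * p) →
    (∀ j → ∑ℕ (n ∸ k) (λ i → A i j) ≡ t * (p ∸ 1)) →
    RCDS (Vmat k t p n A)
theorem2p2 (suc k) (suc t) (suc p) .(suc k * suc p) _ _ _ _ refl A zero-one rowsA colsA =
  ÷-doublyStochastic V G _ V≡G÷tp rows cols ,
  ÷-equalDiagSums V G _ V≡G÷tp (λ i → if toℕ i <ᵇ suc k then suc t else 1)
                  (λ i → Vnum-zeroOrRowConstant (suc k) (suc t) A zero-one (toℕ i))
  where
  V : Matrix ℚ (suc k * suc p) (suc k * suc p)
  V = Vmat (suc k) (suc t) (suc p) (suc k * suc p) A
  G : Matrix ℕ (suc k * suc p) (suc k * suc p)
  G i = Vnum (suc k) (suc t) A (toℕ i)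
  V≡G÷tp : ∀ i j → V i j ≡ G i j ÷ (suc t * suc p)
  V≡G÷tp = Vmat≡Vnum÷ (suc k) (suc t) A (suc p)
  rows : ∀ i → ∑ℕ (suc k * suc p) (G i) ≡ suc t * suc p
  rows = Vnum-rowSum k (suc t) A (suc p) (ℕ.*-comm (suc k) (suc p)) rowsA
  cols : ∀ j → ∑ℕ (suc k * suc p) (λ i → G i j) ≡ suc t * suc p
  cols j = trans (Vnum-columnSum k (suc t) A (ℕ.m≤m*n (suc k) (suc p)) j)
                 (trans (cong (suc t ℕ.+_) (colsA j)) (sym (ℕ.*-suc (suc t) p)))
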